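{- The Cantor string has infinite VC dimension.
   Context: Let $S^{(0)}=1$ and $S^{(i+1)}=S^{(i)}0^{|S^{(i)}|}S^{(i)}$ (concatenation of $S^{(i)}$, $|S^{(i)}|$ zeros, and $S^{(i)}$). The Cantor string is the right-infinite binary string having every $S^{(i)}$ as an initial segment. For a finite binary string $s$ (indexed from $0$), $n(s)=\{i: s_i=1\}$; for a binary string $S$, $\mathfrak{S}=\{n(s): s \text{ a finite contiguous substring of } S\}$; a set $B\subseteq\mathbb{N}$ is shattered if $\{c\cap B: c\in\mathfrak{S}\}$ is the power set of $B$; the VC dimension of $S$ is the supremum of sizes of shattered sets. -}

module Defs where

open import Data.Nat using (ℕ; zero; suc; _+_; _<_; _≤_)
open import Data.Bool using (Bool; true; false)
open import Data.List using (List; []; _∷_; _++_; replicate; length; lookup)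
open import Data.List.Membership.Propositional using (_∈_)
open import Data.List.Relation.Unary.Unique.Propositional using (Unique)
open import Data.Fin using (Fin; toℕ)
open import Data.Product using (Σ; _×_; ∃-syntax)
open import Function.Bundles using (_⇔_)
open import Relation.Binary.PropositionalEquality using (_≡_)

-- S⁽⁰⁾ = 1,  S⁽ⁱ⁺¹⁾ = S⁽ⁱ⁾ 0^|S⁽ⁱ⁾| S⁽ⁱ⁾   (true = 1, false = 0)
S : ℕ → List Bool
S zero    = true ∷ []
S (suc i) = S i ++ replicate (length (S i)) false ++ S i

String∞ : Set
String∞ = ℕ → Bool

IsCantorString : String∞ → Set
IsCantorString c = ∀ i (j : Fin (length (S i))) → c (toℕ j) ≡ lookup (S i) j

-- The finite contiguous substring of X starting at position a with length L
-- is s = X(a) X(a+1) … X(a+L-1); then  i ∈ n(s)  iff  i < L and s_i = X(a+i) = 1.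
_∈n[_,_,_] : ℕ → String∞ → ℕ → ℕ → Set
i ∈n[ X , a , L ] = i < L × X (a + i) ≡ true

-- B (a finite set of naturals, given as a duplicate-free list) is shattered by X:
-- every subset T of B (T given by a Boolean predicate, restricted to B)
-- arises as c ∩ B for some c = n(s), s a finite contiguous substring of X.
Shattered : String∞ → List ℕ → Set
Shattered X B =
  (T : ℕ → Bool) → ∃[ a ] ∃[ L ] (∀ b → b ∈ B → (b ∈n[ X , a , L ] ⇔ (T b ≡ true)))

InfiniteVCDim : String∞ → Set
InfiniteVCDim X = ∀ k → ∃[ B ] (Unique B × k ≤ length B × Shattered X B)

-- A position n carries a 1 in the Cantor string exactly when the ternary expansion of n has no
-- digit 1: replacing every bit b of S⁽ⁱ⁾ by the block b0b gives S⁽ⁱ⁺¹⁾, so the bit at 3n + r is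
-- the bit at n for r ∈ {0, 2} and is 0 for r = 1. To shatter the positions 2·9ʲ (j < k) along a
-- pattern T, start reading at the number a whose base-9 digits are 0 where T holds and 2 where it
-- fails. Adding 2·9ʲ to a turns the j-th digit 0 into 2, keeping the string at 1, or turns the
-- digit 2 into 4 = 1·3 + 1, creating a ternary digit 1 and hence a 0.
module Submission where

open import Defs
open import Data.Nat using (ℕ; zero; suc; _+_; _*_; _^_; _<_; z≤n; s≤s; s<s)
open import Data.Nat.Properties
open import Data.Nat.Tactic.RingSolver using (solve-∀)
open import Data.Bool using (Bool; true; false)
open import Data.List using (List; []; _∷_; _++_; replicate; length; lookup; concatMap; applyUpTo)
open import Data.List.Properties using (concatMap-++; length-applyUpTo)
open import Data.List.Membership.Propositional.Properties using (∈-applyUpTo⁻)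
open import Data.List.Relation.Unary.Unique.Propositional.Properties using (applyUpTo⁺₁)
open import Data.Fin using (Fin; toℕ; fromℕ<)
open import Data.Fin.Properties using (toℕ-fromℕ<)
open import Data.Product using (_×_; _,_; ∃)
open import Function using (_∘_)
open import Function.Bundles using (_⇔_; mk⇔)
open import Relation.Binary.PropositionalEquality using (_≡_; refl; sym; trans; cong; subst; module ≡-Reasoning)

-- Total lookup: positions past the end read as 0.
bit : List Bool → ℕ → Bool
bit []       n       = false
bit (x ∷ xs) zero    = x
bit (x ∷ xs) (suc n) = bit xs n

lookup≡bit : ∀ xs (j : Fin (length xs)) → lookup xs j ≡ bit xs (toℕ j)
lookup≡bit (x ∷ xs) Fin.zero    = refl
lookup≡bit (x ∷ xs) (Fin.suc j) = lookup≡bit xs j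

bit-++ˡ : ∀ xs ys {n} → n < length xs → bit (xs ++ ys) n ≡ bit xs n
bit-++ˡ (x ∷ xs) ys {zero}  _         = refl
bit-++ˡ (x ∷ xs) ys {suc n} (s<s n<l) = bit-++ˡ xs ys n<l

bit-replicate-false : ∀ m n → bit (replicate m false) n ≡ false
bit-replicate-false zero    n       = refl
bit-replicate-false (suc m) zero    = refl
bit-replicate-false (suc m) (suc n) = bit-replicate-false m n

triple : Bool → List Bool
triple b = b ∷ false ∷ b ∷ []

step : List Bool → List Bool
step xs = xs ++ replicate (length xs) false ++ xs

length-concatMap-triple : ∀ xs → length (concatMap triple xs) ≡ 3 * length xs
length-concatMap-triple []       = refl
length-concatMap-triple (x ∷ xs) =
  trans (cong (3 +_) (length-concatMap-triple xs)) (sym (*-suc 3 (length xs)))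

concatMap-triple-replicate : ∀ n → concatMap triple (replicate n false) ≡ replicate (3 * n) false
concatMap-triple-replicate zero    = refl
concatMap-triple-replicate (suc n) =
  trans (cong (λ zs → false ∷ false ∷ false ∷ zs) (concatMap-triple-replicate n))
        (cong (λ m → replicate m false) (sym (*-suc 3 n)))

concatMap-triple-step : ∀ xs → concatMap triple (step xs) ≡ step (concatMap triple xs)
concatMap-triple-step xs = begin
  concatMap triple (xs ++ replicate (length xs) false ++ xs)
    ≡⟨ concatMap-++ triple xs _ ⟩
  ys ++ concatMap triple (replicate (length xs) false ++ xs)
    ≡⟨ cong (ys ++_) (concatMap-++ triple (replicate (length xs) false) xs) ⟩
  ys ++ concatMap triple (replicate (length xs) false) ++ ys
    ≡⟨ cong (λ zs → ys ++ zs ++ ys) (concatMap-triple-replicate (length xs)) ⟩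
  ys ++ replicate (3 * length xs) false ++ ys
    ≡⟨ cong (λ n → ys ++ replicate n false ++ ys) (length-concatMap-triple xs) ⟨
  step ys ∎
  where
  open ≡-Reasoning
  ys : List Bool
  ys = concatMap triple xs

S-suc≡concatMap-triple : ∀ i → S (suc i) ≡ concatMap triple (S i)
S-suc≡concatMap-triple zero    = refl
S-suc≡concatMap-triple (suc i) =
  trans (cong step (S-suc≡concatMap-triple i)) (sym (concatMap-triple-step (S i)))

length-S : ∀ i → length (S i) ≡ 3 ^ i
length-S zero    = refl
length-S (suc i) = begin
  length (S (suc i))                ≡⟨ cong length (S-suc≡concatMap-triple i) ⟩
  length (concatMap triple (S i))   ≡⟨ length-concatMap-triple (S i) ⟩
  3 * length (S i)                  ≡⟨ cong (3 *_) (length-S i) ⟩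
  3 ^ suc i                         ∎
  where open ≡-Reasoning

n<3^n : ∀ n → n < 3 ^ n
n<3^n zero    = s≤s z≤n
n<3^n (suc n) = begin-strict
  suc n      ≤⟨ n<3^n n ⟩
  3 ^ n      <⟨ m<m*n (3 ^ n) 3 ⦃ m^n≢0 3 n ⦄ (s≤s (s≤s z≤n)) ⟩
  3 ^ n * 3  ≡⟨ *-comm (3 ^ n) 3 ⟩
  3 ^ suc n  ∎
  where open ≤-Reasoning

n<length-S : ∀ n → n < length (S n)
n<length-S n = subst (n <_) (sym (length-S n)) (n<3^n n)

r+3*n<length-S : ∀ n {r} → r < 3 → r + 3 * n < length (S (suc n))
r+3*n<length-S n {r} r<3 = begin-strict
  r + 3 * n        <⟨ +-monoˡ-< (3 * n) r<3 ⟩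
  3 + 3 * n        ≡⟨ *-suc 3 n ⟨
  3 * suc n        ≤⟨ *-monoʳ-≤ 3 (n<3^n n) ⟩
  3 ^ suc n        ≡⟨ length-S (suc n) ⟨
  length (S (suc n)) ∎
  where open ≤-Reasoning

bit-concatMap-triple : ∀ xs n {r} → r < 3 → bit (concatMap triple xs) (r + 3 * n) ≡ bit (triple (bit xs n)) r
bit-concatMap-triple []       n       {r} _   = sym (bit-replicate-false 3 r)
bit-concatMap-triple (b ∷ xs) zero    {r} r<3 rewrite +-identityʳ r = bit-++ˡ (triple b) _ r<3
bit-concatMap-triple (b ∷ xs) (suc n) {r} r<3 =
  trans (cong (bit (concatMap triple (b ∷ xs))) (next-block r n)) (bit-concatMap-triple xs n r<3)
  where
  next-block : ∀ r n → r + 3 * suc n ≡ 3 + (r + 3 * n)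
  next-block = solve-∀

digit : Bool → ℕ
digit true  = 0
digit false = 2

-- Base 9 written as 3 * (3 * _), so that cantor-3n and cantor-2+3n apply digit by digit.
code : ℕ → (ℕ → Bool) → ℕ
code zero    P = 0
code (suc k) P = digit (P 0) + 3 * (3 * code k (P ∘ suc))

position : ℕ → ℕ
position j = 2 * 9 ^ j

position-mono-< : ∀ {i j} → i < j → position i < position j
position-mono-< i<j = *-monoʳ-< 2 (^-monoʳ-< 9 (s≤s (s≤s z≤n)) i<j)

module _ (c : String∞) (hc : IsCantorString c) where

  cantor-0 : c 0 ≡ true
  cantor-0 = hc 0 Fin.zero

  cantor≡bit-S : ∀ i {n} → n < length (S i) → c n ≡ bit (S i) n
  cantor≡bit-S i {n} n<l = begin
    c n                       ≡⟨ cong c (toℕ-fromℕ< n<l) ⟨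
    c (toℕ j)                 ≡⟨ hc i j ⟩
    lookup (S i) j            ≡⟨ lookup≡bit (S i) j ⟩
    bit (S i) (toℕ j)         ≡⟨ cong (bit (S i)) (toℕ-fromℕ< n<l) ⟩
    bit (S i) n               ∎
    where
    open ≡-Reasoning
    j : Fin (length (S i))
    j = fromℕ< n<l

  cantor-ternary : ∀ n {r} → r < 3 → c (r + 3 * n) ≡ bit (triple (c n)) r
  cantor-ternary n {r} r<3 = begin
    c (r + 3 * n)                         ≡⟨ cantor≡bit-S (suc n) (r+3*n<length-S n r<3) ⟩
    bit (S (suc n)) (r + 3 * n)           ≡⟨ cong (λ s → bit s (r + 3 * n)) (S-suc≡concatMap-triple n) ⟩
    bit (concatMap triple (S n)) (r + 3 * n) ≡⟨ bit-concatMap-triple (S n) n r<3 ⟩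
    bit (triple (bit (S n) n)) r          ≡⟨ cong (λ b → bit (triple b) r) (cantor≡bit-S n (n<length-S n)) ⟨
    bit (triple (c n)) r                  ∎
    where open ≡-Reasoning

  cantor-3n : ∀ n → c (3 * n) ≡ c n
  cantor-3n n = cantor-ternary n (s≤s z≤n)

  cantor-1+3n : ∀ n → c (1 + 3 * n) ≡ false
  cantor-1+3n n = cantor-ternary n (s≤s (s≤s z≤n))

  cantor-2+3n : ∀ n → c (2 + 3 * n) ≡ c n
  cantor-2+3n n = cantor-ternary n (s≤s (s≤s (s≤s z≤n)))

  cantor-digit : ∀ b x → c (digit b + 3 * (3 * x)) ≡ c x
  cantor-digit true  x = trans (cantor-3n (3 * x)) (cantor-3n x)
  cantor-digit false x = trans (cantor-2+3n (3 * x)) (cantor-3n x)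

  cantor-digit+2 : ∀ b {x} → c x ≡ true → c (digit b + 3 * (3 * x) + 2) ≡ b
  cantor-digit+2 true {x} cx = begin
    c (3 * (3 * x) + 2)      ≡⟨ cong c (+-comm (3 * (3 * x)) 2) ⟩
    c (2 + 3 * (3 * x))      ≡⟨ cantor-digit false x ⟩
    c x                      ≡⟨ cx ⟩
    true                     ∎
    where open ≡-Reasoning
  cantor-digit+2 false {x} _ = begin
    c (2 + 3 * (3 * x) + 2)  ≡⟨ cong c (carry x) ⟩
    c (1 + 3 * (1 + 3 * x))  ≡⟨ cantor-1+3n (1 + 3 * x) ⟩
    false                    ∎
    where
    open ≡-Reasoning
    carry : ∀ x → 2 + 3 * (3 * x) + 2 ≡ 1 + 3 * (1 + 3 * x)
    carry = solve-∀

  cantor-code : ∀ k P → c (code k P) ≡ true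
  cantor-code zero    P = cantor-0
  cantor-code (suc k) P = trans (cantor-digit (P 0) _) (cantor-code k (P ∘ suc))

  cantor-code+position : ∀ k P {j} → j < k → c (code k P + position j) ≡ P j
  cantor-code+position (suc k) P {zero}  _         = cantor-digit+2 (P 0) (cantor-code k (P ∘ suc))
  cantor-code+position (suc k) P {suc j} (s<s j<k) =
    trans (cong c (shift (digit (P 0)) (code k (P ∘ suc)) (9 ^ j)))
          (trans (cantor-digit (P 0) _) (cantor-code+position k (P ∘ suc) j<k))
    where
    shift : ∀ d x y → d + 3 * (3 * x) + 2 * (9 * y) ≡ d + 3 * (3 * (x + 2 * y))
    shift = solve-∀

  cantor-shatters : ∀ k → Shattered c (applyUpTo position k)
  cantor-shatters k T = code k (T ∘ position) , position k , λ b b∈ → reads (∈-applyUpTo⁻ position b∈)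
    where
    reads : ∀ {b} → ∃ (λ j → j < k × b ≡ position j) →
            b ∈n[ c , code k (T ∘ position) , position k ] ⇔ (T b ≡ true)
    reads (j , j<k , refl) = mk⇔
      (λ (_ , hit) → trans (sym (cantor-code+position k (T ∘ position) j<k)) hit)
      (λ t → position-mono-< j<k , trans (cantor-code+position k (T ∘ position) j<k) t)

proposition4 : (c : String∞) → IsCantorString c → InfiniteVCDim c
proposition4 c hc k =
  applyUpTo position k ,
  applyUpTo⁺₁ position k (λ i<j _ → <⇒≢ (position-mono-< i<j)) ,
  ≤-reflexive (sym (length-applyUpTo position k)) ,
  cantor-shatters c hc k
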